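{- Let $G'=(V',E')$ be a graph and $k'$ an integer, and let $(G,k)$ be the instance constructed from $(G',k')$ as described in the context. Let $\ell$ be a normalized optimal hub labeling of $G$ with $|\ell|\le k$. Then $G'$ has a vertex cover of size at most $k'$.
   Context: A hub labeling of a graph $G=(V,E)$ is a map $\ell:V\to 2^V$ such that for all $u,v\in V$ (including $u=v$) some vertex of some shortest $u$-$v$-path in $G$ lies in $\ell(u)\cap\ell(v)$; its size $|\ell|$ is $\sum_{v\in V}|\ell(v)|$ (identifying $\ell$ with the set of pairs $(x,y)$, $y\in\ell(x)$); it is optimal if no hub labeling of $G$ has strictly smaller size. Construction: from a graph $G'=(V',E')$ and integer $k'$, let $\gamma:=8|V'|+3|E'|+k'+2$, $W:=\{w_1,\dots,w_\gamma\}$, $V:=\{w\}\cup W\cup\{v_1,v_2,v_3\mid v\in V'\}$ (all new distinct vertices), $E:=\bigcup_{v\in V'}\{wv_1,v_1v_2,v_2v_3\}\cup\{wx\mid x\in W\}\cup\{u_1v_1\mid uv\in E'\}$, $G=(V,E)$, and $k:=3\gamma-1$. For a hub labeling $\ell$ of $G$: $\ell_v:=\ell\cap\{(v_i,v_j)\mid i,j\in\{1,2,3\},i\ne j\}$ for $v\in V'$, and $\ell_{uv}:=\ell\cap\{(u_i,v_j),(v_j,u_i)\mid i,j\in\{1,2,3\}\}$ for $uv\in E'$. A hub labeling $\ell$ of $G$ is normalized if: (1) for all $u,v\in V$ with $N_G[u]\subsetneq N_G[v]$, $u\notin\ell(v)$; (2) $w\in\ell(x)$ for every $x\in V$, and for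 every $x\in W$ the only $y\in V$ with $x\in\ell(y)$ is $y=x$; (3) for all $v\in V'$, $v_1\in\ell(v_2)$ implies $|\ell_v|>2$; (4) for all $uv\in E'$, $u_1\notin\ell(u_2)$ and $v_1\notin\ell(v_2)$ imply $|\ell_{uv}|>3$. -}

module Defs where

open import Data.Nat using (ℕ; zero; suc; _+_; _*_; _∸_; _≤_; _<_)
open import Data.Fin using (Fin; zero; suc) renaming (_<?_ to _<ᶠ?_)
open import Data.Fin.Properties using (_≟_)
open import Data.Fin.Subset using (Subset; _∈_; ∣_∣)
open import Data.Bool using (Bool; true; false; _∧_; not)
open import Data.List using (List; []; _∷_; map; _++_; concatMap; allFin)
open import Data.Nat.ListAction using (sum)
open import Data.Product using (Σ; _×_)
open import Data.Sum using (_⊎_)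
open import Relation.Nullary using (¬_; yes; no)
open import Relation.Nullary.Decidable using (⌊_⌋)
open import Relation.Binary.PropositionalEquality using (_≡_)

b2n : Bool → ℕ
b2n true  = 1
b2n false = 0

module _ {V : Set} (Adj : V → V → Set) where

  data Walk : V → V → Set where
    []  : ∀ {u} → Walk u u
    _∷_ : ∀ {u v x} → Adj u v → Walk v x → Walk u x

  wlength : ∀ {u v} → Walk u v → ℕ
  wlength []      = 0
  wlength (_ ∷ p) = suc (wlength p)

  data OnWalk (h : V) : {u v : V} → Walk u v → Set where
    start : ∀ {v} {p : Walk h v} → OnWalk h p
    later : ∀ {u v x} {e : Adj u v} {p : Walk v x} → OnWalk h p → OnWalk h (e ∷ p)

  -- a shortest u-v-path: a u-v-walk of minimum length (necessarily a path)
  IsShortest : ∀ {u v} → Walk u v → Set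
  IsShortest {u} {v} p = (q : Walk u v) → wlength p ≤ wlength q

  -- ℓ(u) is {h | ℓ u h ≡ true}
  IsHubLabeling : (V → V → Bool) → Set
  IsHubLabeling ℓ = (u v : V) → Σ (Walk u v) λ p → IsShortest p ×
                      Σ V λ h → OnWalk h p × ℓ u h ≡ true × ℓ v h ≡ true

  InN : V → V → Set
  InN u x = x ≡ u ⊎ Adj u x

  StrictNbhd : V → V → Set
  StrictNbhd u v = ((x : V) → InN u x → InN v x) × Σ V λ x → InN v x × ¬ InN u x

-- size of a labeling, given an enumeration (each vertex exactly once) of V
labelSize : {V : Set} → List V → (V → V → Bool) → ℕ
labelSize es ℓ = sum (map (λ x → sum (map (λ y → b2n (ℓ x y)) es)) es)

-- Input graph G' = (Fin n, E'), E' a symmetric irreflexive adjacency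

IsVertexCover : (n : ℕ) → (Fin n → Fin n → Bool) → Subset n → Set
IsVertexCover n E' C = (u v : Fin n) → E' u v ≡ true → u ∈ C ⊎ v ∈ C

module Construction (n : ℕ) (E' : Fin n → Fin n → Bool) (k' : ℕ) where

  m : ℕ
  m = sum (map (λ i → sum (map (λ j → b2n (⌊ i <ᶠ? j ⌋ ∧ E' i j)) (allFin n))) (allFin n))

  γ : ℕ
  γ = 8 * n + 3 * m + k' + 2

  k : ℕ
  k = 3 * γ ∸ 1

  -- vertices: w, w_1..w_γ (wv i), and v_1,v_2,v_3 (vert v zero/one/two)
  data V : Set where
    w    : V
    wv   : Fin γ → V
    vert : Fin n → Fin 3 → V

  i1 i2 i3 : Fin 3
  i1 = zero
  i2 = suc zero
  i3 = suc (suc zero)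

  allV : List V
  allV = w ∷ (map wv (allFin γ) ++ concatMap (λ v → map (vert v) (allFin 3)) (allFin n))

  inner : Fin 3 → Fin 3 → Bool
  inner zero (suc zero) = true
  inner (suc zero) zero = true
  inner (suc zero) (suc (suc zero)) = true
  inner (suc (suc zero)) (suc zero) = true
  inner _ _ = false

  isOne : Fin 3 → Bool
  isOne zero = true
  isOne _    = false

  adj : V → V → Bool
  adj w (wv _) = true
  adj (wv _) w = true
  adj w (vert _ zero) = true
  adj (vert _ zero) w = true
  adj (vert u i) (vert v j) with u ≟ v
  ... | yes _ = inner i j
  ... | no _  = isOne i ∧ isOne j ∧ E' u v
  adj _ _ = false

  Adj : V → V → Set
  Adj u v = adj u v ≡ true

  size : (V → V → Bool) → ℕ
  size = labelSize allV

  IsHL : (V → V → Bool) → Set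
  IsHL = IsHubLabeling Adj

  IsOptimal : (V → V → Bool) → Set
  IsOptimal ℓ = (ℓ' : V → V → Bool) → IsHL ℓ' → size ℓ ≤ size ℓ'

  sizeV : (V → V → Bool) → Fin n → ℕ
  sizeV ℓ v = sum (map (λ i → sum (map (λ j →
                b2n (not ⌊ i ≟ j ⌋ ∧ ℓ (vert v i) (vert v j))) (allFin 3))) (allFin 3))

  -- |ℓ_uv| (for u ≠ v)
  sizeE : (V → V → Bool) → Fin n → Fin n → ℕ
  sizeE ℓ u v = sum (map (λ i → sum (map (λ j →
                  b2n (ℓ (vert u i) (vert v j)) + b2n (ℓ (vert v j) (vert u i))) (allFin 3))) (allFin 3))

  IsNormalized : (V → V → Bool) → Set
  IsNormalized ℓ =
    -- (1)
    ((u v : V) → StrictNbhd Adj u v → ℓ v u ≡ false) ×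
    -- (2)
    ((x : V) → ℓ x w ≡ true) ×
    ((i : Fin γ) (y : V) → ℓ y (wv i) ≡ true → y ≡ wv i) ×
    -- (3)
    ((v : Fin n) → ℓ (vert v i2) (vert v i1) ≡ true → 2 < sizeV ℓ v) ×
    -- (4)
    ((u v : Fin n) → E' u v ≡ true →
       ℓ (vert u i2) (vert u i1) ≡ false → ℓ (vert v i2) (vert v i1) ≡ false →
       3 < sizeE ℓ u v)

-- Every vertex has w as a hub, w has itself and each w_i has w and itself: 1 + 2γ + 3|V'| hubs.
-- Count in addition the gadget vertices that are hubs of gadget vertices. Each gadget contributes at
-- least five (v_i ∈ ℓ(v_i); v₂ ∈ ℓ(v₃), as N[v₃] ⊊ N[v₂] forbids v₃ ∈ ℓ(v₂); a common hub of v₁ and v₃),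
-- six if v₁ ∈ ℓ(v₂) ("v is chosen"). Each edge uv of G' contributes at least three, because for all
-- a, b the common hub of u_a and v_b lies in one of the two gadgets, and four if neither endpoint is
-- chosen. Since γ = 8|V'| + 3|E'| + k' + 2, the chosen vertices plus the edges without a chosen
-- endpoint number at most k', and the chosen vertices with one endpoint of each such edge cover E'.
-- Common hubs are located by potentials: for 1-Lipschitz φ, ψ, a hub h of x and y satisfies
-- φ h + ψ h ≤ φ x + ψ y + d(x , y).

module Submission where

open import Data.Nat using (ℕ; zero; suc; _+_; _*_; _∸_; _≤_; _<_; z≤n; s≤s; _≤?_; ∣_-_∣)
open import Data.Nat.Properties
  using (+-*-semiring; ≤-refl; ≤-trans; ≤-reflexive; +-mono-≤; +-monoʳ-≤; +-monoˡ-≤; m≤m+n; m≤n+m;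
         +-comm; +-assoc; +-identityʳ; +-suc; n≤1+n; 1+n≰n; +-cancelˡ-≤;
         ∣-∣-comm; ∣-∣-triangle; ∣-∣-identityʳ; m≡n⇒∣m-n∣≡0; module ≤-Reasoning)
open import Data.Nat.Tactic.RingSolver using (solve-∀)
open import Algebra.Properties.Semiring.Sum +-*-semiring
  using (sum; sum-syntax; ∑-distrib-+; ∑-comm; sum-cong-≗; *-distribʳ-sum)
open import Data.Fin using (Fin; zero; suc; toℕ; _<?_) renaming (_<_ to _<ᶠ_)
open import Data.Fin.Properties using (_≟_; all?; ¬∀⟶∃¬; <-cmp; <-irrefl; <-asym)
open import Data.Fin.Subset using (Subset; ∣_∣; _∈_)
open import Data.Bool using (Bool; true; false; _∧_; _∨_; not; if_then_else_)
open import Data.Bool.Properties using (∨-zeroʳ)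
import Data.Nat.ListAction as ListAction
open import Data.Nat.ListAction.Properties using (sum-++)
open import Data.List using (List; []; _∷_; _++_; map; concatMap; allFin; tabulate)
open import Data.List.Properties using (map-++; map-∘; map-tabulate)
import Data.Vec as Vec
open import Data.Vec.Properties using (lookup∘tabulate; lookup⇒[]=)
open import Data.Product using (Σ; _×_; _,_; proj₁; proj₂)
open import Data.Sum using (_⊎_; inj₁; inj₂; [_,_]; reduce)
open import Data.Empty using (⊥-elim)
open import Function using (_∘_; id)
open import Relation.Nullary using (¬_; Dec; yes; no)
open import Relation.Nullary.Decidable using (⌊_⌋; dec-true; isYes≗does)
open import Relation.Binary.Definitions using (tri<; tri≈; tri>)
open import Relation.Binary.PropositionalEquality
  using (_≡_; _≢_; refl; sym; trans; cong; cong₂; subst; module ≡-Reasoning)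
open import Defs

⌊⌋-true : ∀ {A : Set} (a? : Dec A) → A → ⌊ a? ⌋ ≡ true
⌊⌋-true a? a = trans (isYes≗does a?) (dec-true a? a)

∑-mono-≤ : ∀ {n} {f g : Fin n → ℕ} → (∀ i → f i ≤ g i) → sum f ≤ sum g
∑-mono-≤ {zero}  _   = z≤n
∑-mono-≤ {suc n} {f} {g} f≤g = +-mono-≤ (f≤g zero) (∑-mono-≤ {f = f ∘ suc} {g = g ∘ suc} (f≤g ∘ suc))

∑∑-mono-≤ : ∀ {m n} {f g : Fin m → Fin n → ℕ} → (∀ i j → f i j ≤ g i j) →
            ∑[ i < m ] sum (f i) ≤ ∑[ i < m ] sum (g i)
∑∑-mono-≤ f≤g = ∑-mono-≤ (λ i → ∑-mono-≤ (f≤g i))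

∑∑-distrib-+ : ∀ {m n} (f g : Fin m → Fin n → ℕ) →
               ∑[ i < m ] ∑[ j < n ] (f i j + g i j) ≡ ∑[ i < m ] sum (f i) + ∑[ i < m ] sum (g i)
∑∑-distrib-+ f g = trans (sum-cong-≗ (λ i → ∑-distrib-+ (f i) (g i))) (∑-distrib-+ (λ i → sum (f i)) (λ i → sum (g i)))

∑-const : ∀ n c → ∑[ i < n ] c ≡ n * c
∑-const zero    c = refl
∑-const (suc n) c = cong (c +_) (∑-const n c)

term≤∑ : ∀ {n} (f : Fin n → ℕ) i → f i ≤ sum f
term≤∑ f zero    = m≤m+n (f zero) _
term≤∑ f (suc i) = ≤-trans (term≤∑ (f ∘ suc) i) (m≤n+m _ (f zero))

two-terms≤∑ : ∀ {n} (f : Fin n → ℕ) {i j} → i ≢ j → f i + f j ≤ sum f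
two-terms≤∑ f {zero}  {zero}  i≢j = ⊥-elim (i≢j refl)
two-terms≤∑ f {zero}  {suc j} _   = +-monoʳ-≤ (f zero) (term≤∑ (f ∘ suc) j)
two-terms≤∑ f {suc i} {zero}  _   =
  ≤-trans (≤-reflexive (+-comm (f (suc i)) (f zero))) (+-monoʳ-≤ (f zero) (term≤∑ (f ∘ suc) i))
two-terms≤∑ f {suc i} {suc j} i≢j = ≤-trans (two-terms≤∑ (f ∘ suc) (i≢j ∘ cong suc)) (m≤n+m _ (f zero))

2≤∑ : ∀ {n} (f : Fin n → ℕ) {i j} → i ≢ j → 1 ≤ f i → 1 ≤ f j → 2 ≤ sum f
2≤∑ f i≢j fi fj = ≤-trans (+-mono-≤ fi fj) (two-terms≤∑ f i≢j)

n≤∑-of-positive : ∀ {n} (f : Fin n → ℕ) → (∀ i → 1 ≤ f i) → n ≤ sum f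
n≤∑-of-positive {zero}  f _   = z≤n
n≤∑-of-positive {suc n} f pos = +-mono-≤ (pos zero) (n≤∑-of-positive (f ∘ suc) (pos ∘ suc))

-- Either every f a is positive, or some f a vanishes and then every g b is positive.
n≤∑+∑-of-cross-cover : ∀ {n} (f g : Fin n → ℕ) → (∀ a b → 1 ≤ f a ⊎ 1 ≤ g b) → n ≤ sum f + sum g
n≤∑+∑-of-cross-cover {n} f g cover with all? (λ a → 1 ≤? f a)
... | yes rows = ≤-trans (n≤∑-of-positive f rows) (m≤m+n _ _)
... | no ¬rows with ¬∀⟶∃¬ n (λ a → 1 ≤ f a) (λ a → 1 ≤? f a) ¬rows
...   | a , ¬fa = ≤-trans (n≤∑-of-positive g (λ b → [ ⊥-elim ∘ ¬fa , id ] (cover a b))) (m≤n+m _ _)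

∑-diagonal+upper≤∑ : ∀ {n} (A : Fin n → Fin n → ℕ) →
  ∑[ v < n ] A v v + ∑[ v < n ] ∑[ z < n ] (if ⌊ v <? z ⌋ then A v z + A z v else 0)
    ≤ ∑[ v < n ] ∑[ z < n ] A v z
∑-diagonal+upper≤∑ {n} A = begin
  ∑[ v < n ] A v v + ∑[ v < n ] ∑[ z < n ] (if ⌊ v <? z ⌋ then A v z + A z v else 0)
    ≡⟨ cong (∑[ v < n ] A v v +_) upper≡above+below ⟩
  ∑[ v < n ] A v v + (above + below)
    ≤⟨ +-monoˡ-≤ (above + below) (∑-mono-≤ diagonal≤on) ⟩
  on + (above + below)
    ≡⟨ split ⟨
  ∑[ v < n ] ∑[ z < n ] (when ⌊ z ≟ v ⌋ (A v z) + (when ⌊ v <? z ⌋ (A v z) + when ⌊ z <? v ⌋ (A v z)))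
    ≤⟨ ∑∑-mono-≤ (λ v z → trichotomy v z (A v z)) ⟩
  ∑[ v < n ] ∑[ z < n ] A v z ∎
  where
  open ≤-Reasoning
  when : Bool → ℕ → ℕ
  when b x = if b then x else 0

  on above below : ℕ
  on    = ∑[ v < n ] ∑[ z < n ] when ⌊ z ≟ v ⌋ (A v z)
  above = ∑[ v < n ] ∑[ z < n ] when ⌊ v <? z ⌋ (A v z)
  below = ∑[ v < n ] ∑[ z < n ] when ⌊ z <? v ⌋ (A v z)

  when-+ : ∀ b x y → (if b then x + y else 0) ≡ when b x + when b y
  when-+ true  x y = refl
  when-+ false x y = refl

  upper≡above+below : ∑[ v < n ] ∑[ z < n ] (if ⌊ v <? z ⌋ then A v z + A z v else 0) ≡ above + below
  upper≡above+below =
    trans (sum-cong-≗ λ v → sum-cong-≗ λ z → when-+ ⌊ v <? z ⌋ (A v z) (A z v))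
          (trans (∑∑-distrib-+ (λ v z → when ⌊ v <? z ⌋ (A v z)) (λ v z → when ⌊ v <? z ⌋ (A z v)))
                 (cong (above +_) (∑-comm (λ v z → when ⌊ v <? z ⌋ (A z v)))))

  split : ∑[ v < n ] ∑[ z < n ] (when ⌊ z ≟ v ⌋ (A v z) + (when ⌊ v <? z ⌋ (A v z) + when ⌊ z <? v ⌋ (A v z)))
          ≡ on + (above + below)
  split = trans (∑∑-distrib-+ (λ v z → when ⌊ z ≟ v ⌋ (A v z)) (λ v z → when ⌊ v <? z ⌋ (A v z) + when ⌊ z <? v ⌋ (A v z)))
                (cong (on +_) (∑∑-distrib-+ (λ v z → when ⌊ v <? z ⌋ (A v z)) (λ v z → when ⌊ z <? v ⌋ (A v z))))

  diagonal≤on : ∀ v → A v v ≤ ∑[ z < n ] when ⌊ z ≟ v ⌋ (A v z)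
  diagonal≤on v = ≤-trans (≤-reflexive (cong (λ b → when b (A v v)) (sym (⌊⌋-true (v ≟ v) refl))))
                          (term≤∑ (λ z → when ⌊ z ≟ v ⌋ (A v z)) v)

  trichotomy : ∀ v z x → when ⌊ z ≟ v ⌋ x + (when ⌊ v <? z ⌋ x + when ⌊ z <? v ⌋ x) ≤ x
  trichotomy v z x with z ≟ v | v <? z | z <? v
  ... | yes refl | yes v<v | _        = ⊥-elim (<-irrefl refl v<v)
  ... | yes refl | no _    | yes v<v  = ⊥-elim (<-irrefl refl v<v)
  ... | yes refl | no _    | no _     = ≤-reflexive (+-identityʳ x)
  ... | no _     | yes v<z | yes z<v  = ⊥-elim (<-asym v<z z<v)
  ... | no _     | yes _   | no _     = ≤-reflexive (+-identityʳ x)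
  ... | no _     | no _    | yes _    = ≤-refl
  ... | no z≢v   | no v≮z  | no z≮v with <-cmp v z
  ...   | tri< v<z _ _ = ⊥-elim (v≮z v<z)
  ...   | tri≈ _ v≡z _ = ⊥-elim (z≢v (sym v≡z))
  ...   | tri> _ _ z<v = ⊥-elim (z≮v z<v)

listSum-tabulate : ∀ {n} (f : Fin n → ℕ) → ListAction.sum (tabulate f) ≡ sum f
listSum-tabulate {zero}  f = refl
listSum-tabulate {suc n} f = cong (f zero +_) (listSum-tabulate (f ∘ suc))

listSum-allFin : ∀ {n} (f : Fin n → ℕ) → ListAction.sum (map f (allFin n)) ≡ sum f
listSum-allFin f = trans (cong ListAction.sum (map-tabulate id f)) (listSum-tabulate f)

listSum-concatMap : ∀ {A B : Set} (g : B → ℕ) (h : A → List B) xs →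
                    ListAction.sum (map g (concatMap h xs)) ≡ ListAction.sum (map (λ x → ListAction.sum (map g (h x))) xs)
listSum-concatMap g h []       = refl
listSum-concatMap g h (x ∷ xs) = begin
  ListAction.sum (map g (h x ++ concatMap h xs))              ≡⟨ cong ListAction.sum (map-++ g (h x) (concatMap h xs)) ⟩
  ListAction.sum (map g (h x) ++ map g (concatMap h xs))      ≡⟨ sum-++ (map g (h x)) _ ⟩
  ListAction.sum (map g (h x)) + ListAction.sum (map g (concatMap h xs))
    ≡⟨ cong (ListAction.sum (map g (h x)) +_) (listSum-concatMap g h xs) ⟩
  ListAction.sum (map g (h x)) + ListAction.sum (map (λ x → ListAction.sum (map g (h x))) xs) ∎
  where open ≡-Reasoning

∣tabulate∣≡∑ : ∀ {n} (p : Fin n → Bool) → ∣ Vec.tabulate p ∣ ≡ ∑[ i < n ] b2n (p i)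
∣tabulate∣≡∑ {zero}  p = refl
∣tabulate∣≡∑ {suc n} p with p zero
... | true  = cong suc (∣tabulate∣≡∑ (p ∘ suc))
... | false = ∣tabulate∣≡∑ (p ∘ suc)

∈-tabulate : ∀ {n} (p : Fin n → Bool) {i} → p i ≡ true → i ∈ Vec.tabulate p
∈-tabulate p {i} pi = lookup⇒[]= i (Vec.tabulate p) (trans (lookup∘tabulate p i) pi)

1≤b2n : ∀ {b} → b ≡ true → 1 ≤ b2n b
1≤b2n refl = ≤-refl

b2n-∨ : ∀ b c → b2n (b ∨ c) ≤ b2n b + b2n c
b2n-∨ true  c     = s≤s z≤n
b2n-∨ false true  = ≤-refl
b2n-∨ false false = z≤n

b2n-1≤?≤ : ∀ r → b2n ⌊ 1 ≤? r ⌋ ≤ r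
b2n-1≤?≤ r with 1 ≤? r
... | yes 1≤r = 1≤r
... | no _    = z≤n

module HubLabeling {V : Set} (Adj : V → V → Set) where

  OneLipschitz : (V → ℕ) → Set
  OneLipschitz φ = ∀ x y → Adj x y → φ x ≤ suc (φ y) × φ y ≤ suc (φ x)

  ≤-along-walk : ∀ {φ} → OneLipschitz φ → ∀ {x y} (p : Walk Adj x y) → φ x ≤ φ y + wlength Adj p
  ≤-along-walk {φ} lip {y = y} []      = m≤m+n (φ y) 0
  ≤-along-walk {φ} lip {y = y} (e ∷ p) = begin
    φ _                          ≤⟨ proj₁ (lip _ _ e) ⟩
    suc (φ _)                    ≤⟨ s≤s (≤-along-walk lip p) ⟩
    suc (φ y + wlength Adj p)    ≡⟨ +-suc (φ y) _ ⟨
    φ y + wlength Adj (e ∷ p)    ∎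
    where open ≤-Reasoning

  on-walk-bound : ∀ {φ ψ} → OneLipschitz φ → OneLipschitz ψ →
                  ∀ {h x y} (p : Walk Adj x y) → OnWalk Adj h p → φ h + ψ h ≤ φ x + ψ y + wlength Adj p
  on-walk-bound {φ} {ψ} lφ lψ {h} {y = y} p start = begin
    φ h + ψ h                    ≤⟨ +-monoʳ-≤ (φ h) (≤-along-walk lψ p) ⟩
    φ h + (ψ y + wlength Adj p)  ≡⟨ +-assoc (φ h) _ _ ⟨
    φ h + ψ y + wlength Adj p    ∎
    where open ≤-Reasoning
  on-walk-bound {φ} {ψ} lφ lψ {h} {x} {y} (e ∷ p) (later o) = begin
    φ h + ψ h                          ≤⟨ on-walk-bound lφ lψ p o ⟩
    φ _ + ψ y + wlength Adj p          ≤⟨ +-monoˡ-≤ (wlength Adj p) (+-monoˡ-≤ (ψ y) (proj₂ (lφ _ _ e))) ⟩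
    suc (φ x + ψ y + wlength Adj p)    ≡⟨ +-suc (φ x + ψ y) _ ⟨
    φ x + ψ y + wlength Adj (e ∷ p)    ∎
    where open ≤-Reasoning

  module _ {ℓ : V → V → Bool} (hl : IsHubLabeling Adj ℓ) where

    hub-self : ∀ x → ℓ x x ≡ true
    hub-self x with hl x x
    ... | [] , _ , _ , start , ℓxx , _ = ℓxx
    ... | (_ ∷ _) , shortest , _ with shortest []
    ...   | ()

    -- the hub lies on a shortest walk, which is no longer than q
    hub-within : ∀ {φ ψ} → OneLipschitz φ → OneLipschitz ψ → ∀ {x y} (q : Walk Adj x y) →
                 Σ V λ h → ℓ x h ≡ true × ℓ y h ≡ true × φ h + ψ h ≤ φ x + ψ y + wlength Adj q
    hub-within lφ lψ {x} {y} q with hl x y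
    ... | p , shortest , h , onp , ℓxh , ℓyh =
      h , ℓxh , ℓyh , ≤-trans (on-walk-bound lφ lψ p onp) (+-monoʳ-≤ _ (shortest q))

module Reduction (n : ℕ) (E' : Fin n → Fin n → Bool) (k' : ℕ) where
  open Construction n E' k'
  open HubLabeling Adj

  adj-same : ∀ z i j → adj (vert z i) (vert z j) ≡ inner i j
  adj-same z zero    j with z ≟ z
  ... | yes _   = refl
  ... | no z≢z = ⊥-elim (z≢z refl)
  adj-same z (suc i) j with z ≟ z
  ... | yes _   = refl
  ... | no z≢z = ⊥-elim (z≢z refl)

  adj-distinct : ∀ {u v} → u ≢ v → ∀ i j → adj (vert u i) (vert v j) ≡ isOne i ∧ isOne j ∧ E' u v
  adj-distinct {u} {v} u≢v zero    j with u ≟ v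
  ... | yes u≡v = ⊥-elim (u≢v u≡v)
  ... | no _    = refl
  adj-distinct {u} {v} u≢v (suc i) j with u ≟ v
  ... | yes u≡v = ⊥-elim (u≢v u≡v)
  ... | no _    = refl

  gadget-edge : ∀ z i j → inner i j ≡ true → Adj (vert z i) (vert z j)
  gadget-edge z i j ij = trans (adj-same z i j) ij

  link-edge : ((u : Fin n) → E' u u ≡ false) → ∀ {u v} → E' u v ≡ true → Adj (vert u i1) (vert v i1)
  link-edge irrefl {u} {v} uv = trans (adj-distinct u≢v i1 i1) uv
    where
    u≢v : u ≢ v
    u≢v refl with trans (sym (irrefl u)) uv
    ... | ()

  data NearW : V → Set where
    centre : NearW w
    leaf   : ∀ i → NearW (wv i)
    first  : ∀ z → NearW (vert z i1)

  data EdgeView : V → V → Set where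
    inside : ∀ z {i j} → inner i j ≡ true → EdgeView (vert z i) (vert z j)
    near-w : ∀ {x y} → NearW x → NearW y → EdgeView x y

  edge-view : ∀ {x y} → Adj x y → EdgeView x y
  edge-view {w}          {wv i}         _ = near-w centre (leaf i)
  edge-view {wv i}       {w}            _ = near-w (leaf i) centre
  edge-view {w}          {vert z zero}  _ = near-w centre (first z)
  edge-view {vert z zero} {w}           _ = near-w (first z) centre
  edge-view {vert u i}   {vert v j}       = gadgets u v i j
    where
    gadgets : ∀ u v i j → adj (vert u i) (vert v j) ≡ true → EdgeView (vert u i) (vert v j)
    gadgets u v i j e with u ≟ v
    ... | yes refl = inside u (trans (sym (adj-same u i j)) e)
    ... | no u≢v   = link i j (trans (sym (adj-distinct u≢v i j)) e)
      where
      link : ∀ i j → isOne i ∧ isOne j ∧ E' u v ≡ true → EdgeView (vert u i) (vert v j)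
      link zero    zero    _ = near-w (first u) (first v)
      link zero    (suc _) ()
      link (suc _) _       ()
  edge-view {w}              {w}              ()
  edge-view {w}              {vert _ (suc _)} ()
  edge-view {wv _}           {wv _}           ()
  edge-view {wv _}           {vert _ _}       ()
  edge-view {vert _ zero}    {wv _}           ()
  edge-view {vert _ (suc _)} {w}              ()
  edge-view {vert _ (suc _)} {wv _}           ()

  InGadget : Fin n → V → Set
  InGadget z h = Σ (Fin 3) λ k → h ≡ vert z k

  -- A lower bound for the distance from u_a, exact on the gadget of u.
  pot : Fin n → Fin 3 → V → ℕ
  pot u a (vert z k) with z ≟ u
  ... | yes _ = ∣ toℕ a - toℕ k ∣
  ... | no _  = suc (toℕ a)
  pot u a _ = suc (toℕ a)

  pot-gadget : ∀ u a k → pot u a (vert u k) ≡ ∣ toℕ a - toℕ k ∣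
  pot-gadget u a k with u ≟ u
  ... | yes _   = refl
  ... | no u≢u = ⊥-elim (u≢u refl)

  pot-centre : ∀ u a → pot u a (vert u a) ≡ 0
  pot-centre u a = trans (pot-gadget u a a) (m≡n⇒∣m-n∣≡0 {toℕ a} refl)

  pot-near-w : ∀ u a {x} → NearW x → toℕ a ≤ pot u a x × pot u a x ≤ suc (toℕ a)
  pot-near-w u a centre   = n≤1+n _ , ≤-refl
  pot-near-w u a (leaf _) = n≤1+n _ , ≤-refl
  pot-near-w u a (first z) with z ≟ u
  ... | yes _ = ≤-reflexive (sym (∣-∣-identityʳ (toℕ a))) , ≤-trans (≤-reflexive (∣-∣-identityʳ (toℕ a))) (n≤1+n _)
  ... | no _  = n≤1+n _ , ≤-refl

  inner-distance : ∀ i j → inner i j ≡ true → ∣ toℕ i - toℕ j ∣ ≡ 1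
  inner-distance zero             (suc zero)       _ = refl
  inner-distance (suc zero)       zero             _ = refl
  inner-distance (suc zero)       (suc (suc zero)) _ = refl
  inner-distance (suc (suc zero)) (suc zero)       _ = refl
  inner-distance zero             zero             ()
  inner-distance zero             (suc (suc zero)) ()
  inner-distance (suc zero)       (suc zero)       ()
  inner-distance (suc (suc zero)) zero             ()
  inner-distance (suc (suc zero)) (suc (suc zero)) ()

  pot-lipschitz : ∀ u a → OneLipschitz (pot u a)
  pot-lipschitz u a x y e with edge-view {x} {y} e
  ... | near-w nx ny = step (pot-near-w u a nx) (pot-near-w u a ny) , step (pot-near-w u a ny) (pot-near-w u a nx)
    where
    step : ∀ {p q} → toℕ a ≤ p × p ≤ suc (toℕ a) → toℕ a ≤ q × q ≤ suc (toℕ a) → p ≤ suc q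
    step (_ , p≤) (a≤q , _) = ≤-trans p≤ (s≤s a≤q)
  ... | inside z {i} {j} ij with z ≟ u
  ...   | yes _ = step (toℕ a) (toℕ j) (toℕ i) (trans (∣-∣-comm (toℕ j) (toℕ i)) (inner-distance i j ij))
                , step (toℕ a) (toℕ i) (toℕ j) (inner-distance i j ij)
    where
    step : ∀ x y z → ∣ y - z ∣ ≡ 1 → ∣ x - z ∣ ≤ suc ∣ x - y ∣
    step x y z yz = ≤-trans (∣-∣-triangle x y z) (≤-reflexive (trans (cong (∣ x - y ∣ +_) yz) (+-comm _ 1)))
  ...   | no _  = n≤1+n _ , n≤1+n _

  descend : ∀ z a {y} → Walk Adj (vert z i1) y → Walk Adj (vert z a) y
  descend z zero             q = q
  descend z (suc zero)       q = gadget-edge z i2 i1 refl ∷ q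
  descend z (suc (suc zero)) q = gadget-edge z i3 i2 refl ∷ gadget-edge z i2 i1 refl ∷ q

  descend-length : ∀ z a {y} (q : Walk Adj (vert z i1) y) → wlength Adj (descend z a q) ≡ toℕ a + wlength Adj q
  descend-length z zero             q = refl
  descend-length z (suc zero)       q = refl
  descend-length z (suc (suc zero)) q = refl

  climb : ∀ z b → Walk Adj (vert z i1) (vert z b)
  climb z zero             = []
  climb z (suc zero)       = gadget-edge z i1 i2 refl ∷ []
  climb z (suc (suc zero)) = gadget-edge z i1 i2 refl ∷ gadget-edge z i2 i3 refl ∷ []

  climb-length : ∀ z b → wlength Adj (climb z b) ≡ toℕ b
  climb-length z zero             = refl
  climb-length z (suc zero)       = refl
  climb-length z (suc (suc zero)) = refl

  between : ∀ {u v} → Adj (vert u i1) (vert v i1) → ∀ a b → Walk Adj (vert u a) (vert v b)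
  between {u} {v} link a b = descend u a (link ∷ climb v b)

  between-length : ∀ {u v} (link : Adj (vert u i1) (vert v i1)) a b →
                   wlength Adj (between link a b) ≡ suc (toℕ a + toℕ b)
  between-length {u} {v} link a b = begin
    wlength Adj (between link a b)  ≡⟨ descend-length u a (link ∷ climb v b) ⟩
    toℕ a + suc (wlength Adj (climb v b)) ≡⟨ cong (λ t → toℕ a + suc t) (climb-length v b) ⟩
    toℕ a + suc (toℕ b)             ≡⟨ +-suc (toℕ a) (toℕ b) ⟩
    suc (toℕ a + toℕ b)             ∎
    where open ≡-Reasoning

  N[v₃]⊊N[v₂] : ∀ v → StrictNbhd Adj (vert v i3) (vert v i2)
  N[v₃]⊊N[v₂] v = sub , vert v i1 , inj₂ (gadget-edge v i2 i1 refl) , v₁∉N[v₃]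
    where
    sub : ∀ x → InN Adj (vert v i3) x → InN Adj (vert v i2) x
    sub _ (inj₁ refl) = inj₂ (gadget-edge v i2 i3 refl)
    sub x (inj₂ e) with edge-view {vert v i3} {x} e
    ... | inside _ {j = zero}             ()
    ... | inside _ {j = suc zero}         _ = inj₁ refl
    ... | inside _ {j = suc (suc zero)}   ()
    ... | near-w () _

    v₁∉N[v₃] : ¬ InN Adj (vert v i3) (vert v i1)
    v₁∉N[v₃] (inj₂ e) with edge-view {vert v i3} {vert v i1} e
    ... | inside _ ()
    ... | near-w () _

  sum-allV : ∀ g → ListAction.sum (map g allV) ≡ g w + (∑[ i < γ ] g (wv i) + ∑[ v < n ] ∑[ a < 3 ] g (vert v a))
  sum-allV g = cong (g w +_) (begin
    ListAction.sum (map g (leaves ++ gadgets))                   ≡⟨ cong ListAction.sum (map-++ g leaves gadgets) ⟩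
    ListAction.sum (map g leaves ++ map g gadgets)               ≡⟨ sum-++ (map g leaves) (map g gadgets) ⟩
    ListAction.sum (map g leaves) + ListAction.sum (map g gadgets)
      ≡⟨ cong₂ _+_ (trans (cong ListAction.sum (sym (map-∘ (allFin γ)))) (listSum-allFin (g ∘ wv)))
                   (trans (listSum-concatMap g (λ v → map (vert v) (allFin 3)) (allFin n))
                          (listSum-allFin (λ v → ∑[ a < 3 ] g (vert v a)))) ⟩
    ∑[ i < γ ] g (wv i) + ∑[ v < n ] ∑[ a < 3 ] g (vert v a)     ∎)
    where
    open ≡-Reasoning
    leaves gadgets : List V
    leaves  = map wv (allFin γ)
    gadgets = concatMap (λ v → map (vert v) (allFin 3)) (allFin n)

  module Hubs {ℓ : V → V → Bool} (hl : IsHL ℓ) where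

    hub-in-gadgets : ∀ {u v a b} (q : Walk Adj (vert u a) (vert v b)) → wlength Adj q ≤ suc (toℕ a + toℕ b) →
                     Σ V λ h → ℓ (vert u a) h ≡ true × ℓ (vert v b) h ≡ true ×
                               (InGadget u h ⊎ InGadget v h) × pot u a h + pot v b h ≤ wlength Adj q
    hub-in-gadgets {u} {v} {a} {b} q short
      with hub-within hl {φ = pot u a} {ψ = pot v b} (pot-lipschitz u a) (pot-lipschitz v b) q
    ... | h , ℓuh , ℓvh , near = h , ℓuh , ℓvh , locate h close , close
      where
      close : pot u a h + pot v b h ≤ wlength Adj q
      close = subst (λ t → pot u a h + pot v b h ≤ t + wlength Adj q)
                    (cong₂ _+_ (pot-centre u a) (pot-centre v b)) near

      too-far : suc (toℕ a) + suc (toℕ b) ≤ wlength Adj q → ∀ {A : Set} → A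
      too-far le = ⊥-elim (1+n≰n (≤-trans (≤-reflexive (cong suc (sym (+-suc (toℕ a) (toℕ b))))) (≤-trans le short)))

      locate : ∀ h → pot u a h + pot v b h ≤ wlength Adj q → InGadget u h ⊎ InGadget v h
      locate w          le = too-far le
      locate (wv _)     le = too-far le
      locate (vert z k) le with z ≟ u | z ≟ v
      ... | yes refl | _        = inj₁ (k , refl)
      ... | no _     | yes refl = inj₂ (k , refl)
      ... | no _     | no _     = too-far le

    hub-in-gadget : ∀ {v a b} (q : Walk Adj (vert v a) (vert v b)) → wlength Adj q ≤ suc (toℕ a + toℕ b) →
                    Σ (Fin 3) λ k → ℓ (vert v a) (vert v k) ≡ true × ℓ (vert v b) (vert v k) ≡ true ×
                                    ∣ toℕ a - toℕ k ∣ + ∣ toℕ b - toℕ k ∣ ≤ wlength Adj q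
    hub-in-gadget {v} {a} {b} q short with hub-in-gadgets q short
    ... | _ , ℓah , ℓbh , place , close with reduce place
    ...   | k , refl = k , ℓah , ℓbh , subst (_≤ wlength Adj q) (cong₂ _+_ (pot-gadget v a k) (pot-gadget v b k)) close

    chosen : Fin n → Bool
    chosen v = ℓ (vert v i2) (vert v i1)

    Dominance : Set
    Dominance = ∀ x y → StrictNbhd Adj x y → ℓ y x ≡ false

    LargeGadgets : Set
    LargeGadgets = ∀ v → chosen v ≡ true → 2 < sizeV ℓ v

    LargeEdges : Set
    LargeEdges = ∀ u v → E' u v ≡ true → chosen u ≡ false → chosen v ≡ false → 3 < sizeE ℓ u v

    v₂∈ℓ[v₃] : Dominance → ∀ v → ℓ (vert v i3) (vert v i2) ≡ true
    v₂∈ℓ[v₃] dominated v with hub-in-gadget {a = i2} {b = i3} (gadget-edge v i2 i3 refl ∷ []) (s≤s z≤n)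
    ... | zero           , _   , _   , s≤s ()
    ... | suc zero       , _   , ℓ₃₂ , _ = ℓ₃₂
    ... | suc (suc zero) , ℓ₂₃ , _   , _ with trans (sym ℓ₂₃) (dominated _ _ (N[v₃]⊊N[v₂] v))
    ...   | ()

    v₁v₃-hub : ∀ v → ℓ (vert v i3) (vert v i1) ≡ true ⊎ ℓ (vert v i1) (vert v i2) ≡ true
                         ⊎ ℓ (vert v i1) (vert v i3) ≡ true
    v₁v₃-hub v with hub-in-gadget {a = i1} {b = i3} (climb v i3) (n≤1+n 2)
    ... | zero           , _   , ℓ₃₁ , _ = inj₁ ℓ₃₁
    ... | suc zero       , ℓ₁₂ , _   , _ = inj₂ (inj₁ ℓ₁₂)
    ... | suc (suc zero) , ℓ₁₃ , _   , _ = inj₂ (inj₂ ℓ₁₃)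

    offDiagonal : Fin n → Fin 3 → Fin 3 → ℕ
    offDiagonal v i j = b2n (not ⌊ i ≟ j ⌋ ∧ ℓ (vert v i) (vert v j))

    2≤sizeV : Dominance → ∀ v → 2 ≤ sizeV ℓ v
    2≤sizeV dominated v = from-hub (v₁v₃-hub v)
      where
      row : Fin 3 → ℕ
      row i = sum (offDiagonal v i)

      row₃ : 1 ≤ row i3
      row₃ = ≤-trans (1≤b2n (v₂∈ℓ[v₃] dominated v)) (term≤∑ (offDiagonal v i3) i2)

      from-hub : ℓ (vert v i3) (vert v i1) ≡ true ⊎ ℓ (vert v i1) (vert v i2) ≡ true
                   ⊎ ℓ (vert v i1) (vert v i3) ≡ true → 2 ≤ sizeV ℓ v
      from-hub (inj₁ ℓ₃₁) =
        ≤-trans (2≤∑ (offDiagonal v i3) {i1} {i2} (λ ()) (1≤b2n ℓ₃₁) (1≤b2n (v₂∈ℓ[v₃] dominated v))) (term≤∑ row i3)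
      from-hub (inj₂ (inj₁ ℓ₁₂)) = 2≤∑ row {i1} {i3} (λ ()) (≤-trans (1≤b2n ℓ₁₂) (term≤∑ (offDiagonal v i1) i2)) row₃
      from-hub (inj₂ (inj₂ ℓ₁₃)) = 2≤∑ row {i1} {i3} (λ ()) (≤-trans (1≤b2n ℓ₁₃) (term≤∑ (offDiagonal v i1) i3)) row₃

    hubsIn : V → Fin n → ℕ
    hubsIn x z = ∑[ k < 3 ] b2n (ℓ x (vert z k))

    hubsBetween : Fin n → Fin n → ℕ
    hubsBetween u v = ∑[ a < 3 ] hubsIn (vert u a) v

    3+sizeV≤hubsBetween : ∀ v → 3 + sizeV ℓ v ≤ hubsBetween v v
    3+sizeV≤hubsBetween v = begin
      3 + sizeV ℓ v                                             ≡⟨ +-comm 3 (sizeV ℓ v) ⟩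
      sizeV ℓ v + 3                                             ≡⟨ ∑∑-distrib-+ (offDiagonal v) diagonal ⟨
      ∑[ i < 3 ] ∑[ j < 3 ] (offDiagonal v i j + diagonal i j)  ≤⟨ ∑∑-mono-≤ entry ⟩
      hubsBetween v v                                           ∎
      where
      open ≤-Reasoning
      diagonal : Fin 3 → Fin 3 → ℕ
      diagonal i j = b2n ⌊ i ≟ j ⌋

      entry : ∀ i j → offDiagonal v i j + diagonal i j ≤ b2n (ℓ (vert v i) (vert v j))
      entry i j with i ≟ j
      ... | yes refl = 1≤b2n (hub-self hl (vert v i))
      ... | no _     = ≤-reflexive (+-identityʳ _)

    5+chosen≤hubsBetween : Dominance → LargeGadgets → ∀ v → 5 + b2n (chosen v) ≤ hubsBetween v v
    5+chosen≤hubsBetween dominated large v = ≤-trans (+-monoʳ-≤ 3 (by-choice (chosen v) refl)) (3+sizeV≤hubsBetween v)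
      where
      by-choice : ∀ b → chosen v ≡ b → 2 + b2n b ≤ sizeV ℓ v
      by-choice true  chosen = large v chosen
      by-choice false _      = 2≤sizeV dominated v

    edge-hub : ((u : Fin n) → E' u u ≡ false) → ∀ {u v} → E' u v ≡ true →
               ∀ a b → 1 ≤ hubsIn (vert u a) v ⊎ 1 ≤ hubsIn (vert v b) u
    edge-hub irrefl {u} {v} uv a b
      with hub-in-gadgets (between (link-edge irrefl uv) a b) (≤-reflexive (between-length (link-edge irrefl uv) a b))
    ... | _ , _   , ℓvh , inj₁ (k , refl) , _ = inj₂ (≤-trans (1≤b2n ℓvh) (term≤∑ (λ k → b2n (ℓ (vert v b) (vert u k))) k))
    ... | _ , ℓuh , _   , inj₂ (k , refl) , _ = inj₁ (≤-trans (1≤b2n ℓuh) (term≤∑ (λ k → b2n (ℓ (vert u a) (vert v k))) k))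

    3≤hubsBetween-edge : ((u : Fin n) → E' u u ≡ false) → ∀ {u v} → E' u v ≡ true → 3 ≤ hubsBetween u v + hubsBetween v u
    3≤hubsBetween-edge irrefl {u} {v} uv =
      n≤∑+∑-of-cross-cover (λ a → hubsIn (vert u a) v) (λ b → hubsIn (vert v b) u) (edge-hub irrefl uv)

    sizeE≡hubsBetween : ∀ u v → sizeE ℓ u v ≡ hubsBetween u v + hubsBetween v u
    sizeE≡hubsBetween u v =
      trans (∑∑-distrib-+ (λ i j → b2n (ℓ (vert u i) (vert v j))) (λ i j → b2n (ℓ (vert v j) (vert u i))))
            (cong (hubsBetween u v +_) (∑-comm (λ i j → b2n (ℓ (vert v j) (vert u i)))))

    isEdge : Fin n → Fin n → Bool
    isEdge u v = ⌊ u <? v ⌋ ∧ E' u v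

    uncovered : Fin n → Fin n → Bool
    uncovered u v = isEdge u v ∧ (not (chosen u) ∧ not (chosen v))

    edge-cost≤hubsBetween : ((u : Fin n) → E' u u ≡ false) → LargeEdges → ∀ u v →
      b2n (isEdge u v) * 3 + b2n (uncovered u v) ≤ (if ⌊ u <? v ⌋ then hubsBetween u v + hubsBetween v u else 0)
    edge-cost≤hubsBetween irrefl large u v with ⌊ u <? v ⌋
    ... | false = z≤n
    ... | true with E' u v in uv
    ...   | false = z≤n
    ...   | true with chosen u in cu | chosen v in cv
    ...     | true  | _     = 3≤hubsBetween-edge irrefl uv
    ...     | false | true  = 3≤hubsBetween-edge irrefl uv
    ...     | false | false = subst (4 ≤_) (sizeE≡hubsBetween u v) (large u v uv cu cv)

    hubCount : V → ℕ
    hubCount x = ListAction.sum (map (λ y → b2n (ℓ x y)) allV)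

    1+hubsIn≤hubCount : ∀ x → ℓ x w ≡ true → 1 + ∑[ z < n ] hubsIn x z ≤ hubCount x
    1+hubsIn≤hubCount x ℓxw = begin
      1 + ∑[ z < n ] hubsIn x z                                                 ≤⟨ +-mono-≤ (1≤b2n ℓxw) (m≤n+m _ _) ⟩
      b2n (ℓ x w) + (∑[ i < γ ] b2n (ℓ x (wv i)) + ∑[ z < n ] hubsIn x z)       ≡⟨ sum-allV (λ y → b2n (ℓ x y)) ⟨
      hubCount x                                                                ∎
      where open ≤-Reasoning

    2≤hubCount-leaf : (∀ x → ℓ x w ≡ true) → ∀ i → 2 ≤ hubCount (wv i)
    2≤hubCount-leaf hub-w i = begin
      2                                                     ≤⟨ +-mono-≤ (1≤b2n (hub-w (wv i))) self ⟩
      b2n (ℓ (wv i) w) + ∑[ j < γ ] b2n (ℓ (wv i) (wv j))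
                                                            ≤⟨ +-monoʳ-≤ (b2n (ℓ (wv i) w)) (m≤m+n _ _) ⟩
      b2n (ℓ (wv i) w) + (∑[ j < γ ] b2n (ℓ (wv i) (wv j)) + ∑[ z < n ] hubsIn (wv i) z)
                                                            ≡⟨ sum-allV (λ y → b2n (ℓ (wv i) y)) ⟨
      hubCount (wv i)                                       ∎
      where
      open ≤-Reasoning
      self : 1 ≤ ∑[ j < γ ] b2n (ℓ (wv i) (wv j))
      self = ≤-trans (1≤b2n (hub-self hl (wv i))) (term≤∑ (λ j → b2n (ℓ (wv i) (wv j))) i)

    ∑-gadget-rows : ∑[ v < n ] ∑[ a < 3 ] (1 + ∑[ z < n ] hubsIn (vert v a) z) ≡ n * 3 + ∑[ v < n ] ∑[ z < n ] hubsBetween v z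
    ∑-gadget-rows = begin
      ∑[ v < n ] ∑[ a < 3 ] (1 + ∑[ z < n ] hubsIn (vert v a) z)
        ≡⟨ sum-cong-≗ (λ v → ∑-distrib-+ (λ _ → 1) (λ a → ∑[ z < n ] hubsIn (vert v a) z)) ⟩
      ∑[ v < n ] (3 + ∑[ a < 3 ] ∑[ z < n ] hubsIn (vert v a) z)
        ≡⟨ sum-cong-≗ (λ v → cong (3 +_) (∑-comm (λ a z → hubsIn (vert v a) z))) ⟩
      ∑[ v < n ] (3 + ∑[ z < n ] hubsBetween v z)
        ≡⟨ ∑-distrib-+ (λ _ → 3) (λ v → ∑[ z < n ] hubsBetween v z) ⟩
      ∑[ v < n ] 3 + ∑[ v < n ] ∑[ z < n ] hubsBetween v z
        ≡⟨ cong (_+ ∑[ v < n ] ∑[ z < n ] hubsBetween v z) (∑-const n 3) ⟩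
      n * 3 + ∑[ v < n ] ∑[ z < n ] hubsBetween v z ∎
      where open ≡-Reasoning

    size≥∑hubsBetween : (∀ x → ℓ x w ≡ true) → 1 + (γ * 2 + (n * 3 + ∑[ v < n ] ∑[ z < n ] hubsBetween v z)) ≤ size ℓ
    size≥∑hubsBetween hub-w = begin
      1 + (γ * 2 + (n * 3 + ∑[ v < n ] ∑[ z < n ] hubsBetween v z))
        ≡⟨ cong₂ (λ s t → 1 + (s + t)) (∑-const γ 2) ∑-gadget-rows ⟨
      1 + (∑[ i < γ ] 2 + ∑[ v < n ] ∑[ a < 3 ] (1 + ∑[ z < n ] hubsIn (vert v a) z))
        ≤⟨ +-mono-≤ (≤-trans (1≤b2n (hub-self hl w)) (m≤m+n _ _))
                    (+-mono-≤ (∑-mono-≤ (2≤hubCount-leaf hub-w))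
                              (∑∑-mono-≤ (λ v a → 1+hubsIn≤hubCount (vert v a) (hub-w (vert v a))))) ⟩
      hubCount w + (∑[ i < γ ] hubCount (wv i) + ∑[ v < n ] ∑[ a < 3 ] hubCount (vert v a))
        ≡⟨ sum-allV hubCount ⟨
      size ℓ ∎
      where open ≤-Reasoning

    #chosen : ℕ
    #chosen = ∑[ v < n ] b2n (chosen v)

    #uncovered : ℕ
    #uncovered = ∑[ u < n ] ∑[ v < n ] b2n (uncovered u v)

    m≡∑∑isEdge : m ≡ ∑[ u < n ] ∑[ v < n ] b2n (isEdge u v)
    m≡∑∑isEdge = trans (listSum-allFin (λ u → ListAction.sum (map (λ v → b2n (isEdge u v)) (allFin n))))
                       (sum-cong-≗ (λ u → listSum-allFin (λ v → b2n (isEdge u v))))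

    ∑∑isEdge*3 : (∑[ u < n ] ∑[ v < n ] b2n (isEdge u v)) * 3 ≡ ∑[ u < n ] ∑[ v < n ] (b2n (isEdge u v) * 3)
    ∑∑isEdge*3 = trans (*-distribʳ-sum 3 (λ u → ∑[ v < n ] b2n (isEdge u v)))
                       (sum-cong-≗ (λ u → *-distribʳ-sum 3 (λ v → b2n (isEdge u v))))

    ∑hubsBetween≥ : Dominance → LargeGadgets → ((u : Fin n) → E' u u ≡ false) → LargeEdges →
                    n * 5 + #chosen + (m * 3 + #uncovered) ≤ ∑[ u < n ] ∑[ v < n ] hubsBetween u v
    ∑hubsBetween≥ dominated large-gadgets irrefl large-edges = begin
      n * 5 + #chosen + (m * 3 + #uncovered)
        ≡⟨ cong₂ (λ s t → s + #chosen + (t * 3 + #uncovered)) (∑-const n 5) (sym m≡∑∑isEdge) ⟨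
      ∑[ v < n ] 5 + #chosen + ((∑[ u < n ] ∑[ v < n ] b2n (isEdge u v)) * 3 + #uncovered)
        ≡⟨ cong₂ _+_ (∑-distrib-+ (λ _ → 5) (b2n ∘ chosen))
                     (trans (∑∑-distrib-+ edgeCost (λ u v → b2n (uncovered u v))) (cong (_+ #uncovered) (sym ∑∑isEdge*3))) ⟨
      ∑[ v < n ] (5 + b2n (chosen v)) + ∑[ u < n ] ∑[ v < n ] (edgeCost u v + b2n (uncovered u v))
        ≤⟨ +-mono-≤ (∑-mono-≤ (5+chosen≤hubsBetween dominated large-gadgets))
                    (∑∑-mono-≤ (edge-cost≤hubsBetween irrefl large-edges)) ⟩
      ∑[ v < n ] hubsBetween v v + ∑[ u < n ] ∑[ v < n ] (if ⌊ u <? v ⌋ then hubsBetween u v + hubsBetween v u else 0)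
        ≤⟨ ∑-diagonal+upper≤∑ hubsBetween ⟩
      ∑[ u < n ] ∑[ v < n ] hubsBetween u v ∎
      where
      open ≤-Reasoning
      edgeCost : Fin n → Fin n → ℕ
      edgeCost u v = b2n (isEdge u v) * 3

    size-lower-bound : Dominance → (∀ x → ℓ x w ≡ true) → LargeGadgets → ((u : Fin n) → E' u u ≡ false) → LargeEdges →
                       1 + γ * 2 + n * 8 + m * 3 + (#chosen + #uncovered) ≤ size ℓ
    size-lower-bound dominated hub-w large-gadgets irrefl large-edges = begin
      1 + γ * 2 + n * 8 + m * 3 + (#chosen + #uncovered)
        ≡⟨ regroup γ n m #chosen #uncovered ⟩
      1 + (γ * 2 + (n * 3 + (n * 5 + #chosen + (m * 3 + #uncovered))))
        ≤⟨ +-monoʳ-≤ 1 (+-monoʳ-≤ (γ * 2) (+-monoʳ-≤ (n * 3) (∑hubsBetween≥ dominated large-gadgets irrefl large-edges))) ⟩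
      1 + (γ * 2 + (n * 3 + ∑[ u < n ] ∑[ v < n ] hubsBetween u v))
        ≤⟨ size≥∑hubsBetween hub-w ⟩
      size ℓ ∎
      where
      open ≤-Reasoning
      regroup : ∀ g n m c u → 1 + g * 2 + n * 8 + m * 3 + (c + u) ≡ 1 + (g * 2 + (n * 3 + (n * 5 + c + (m * 3 + u))))
      regroup = solve-∀

    uncoveredFrom : Fin n → ℕ
    uncoveredFrom u = ∑[ v < n ] b2n (uncovered u v)

    inCover : Fin n → Bool
    inCover u = chosen u ∨ ⌊ 1 ≤? uncoveredFrom u ⌋

    cover : Subset n
    cover = Vec.tabulate inCover

    ∣cover∣≤ : ∣ cover ∣ ≤ #chosen + #uncovered
    ∣cover∣≤ = begin
      ∣ cover ∣
        ≡⟨ ∣tabulate∣≡∑ inCover ⟩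
      ∑[ u < n ] b2n (inCover u)
        ≤⟨ ∑-mono-≤ (λ u → ≤-trans (b2n-∨ (chosen u) _) (+-monoʳ-≤ (b2n (chosen u)) (b2n-1≤?≤ (uncoveredFrom u)))) ⟩
      ∑[ u < n ] (b2n (chosen u) + uncoveredFrom u)
        ≡⟨ ∑-distrib-+ (b2n ∘ chosen) uncoveredFrom ⟩
      #chosen + #uncovered ∎
      where open ≤-Reasoning

    chosen⇒∈cover : ∀ {u} → chosen u ≡ true → u ∈ cover
    chosen⇒∈cover {u} cu = ∈-tabulate inCover (cong (_∨ ⌊ 1 ≤? uncoveredFrom u ⌋) cu)

    uncovered⇒∈cover : ∀ {u v} → uncovered u v ≡ true → u ∈ cover
    uncovered⇒∈cover {u} {v} uv = ∈-tabulate inCover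
      (trans (cong (chosen u ∨_) (⌊⌋-true (1 ≤? uncoveredFrom u) (≤-trans (1≤b2n uv) (term≤∑ (λ v → b2n (uncovered u v)) v))))
             (∨-zeroʳ (chosen u)))

    uncovered-edge : ∀ {u v} → u <ᶠ v → E' u v ≡ true → chosen u ≡ false → chosen v ≡ false → uncovered u v ≡ true
    uncovered-edge {u} {v} u<v uv cu cv =
      cong₂ _∧_ (cong₂ _∧_ (⌊⌋-true (u <? v) u<v) uv) (cong₂ _∧_ (cong not cu) (cong not cv))

    cover-isVertexCover : ((u v : Fin n) → E' u v ≡ E' v u) → ((u : Fin n) → E' u u ≡ false) →
                          IsVertexCover n E' cover
    cover-isVertexCover symm irrefl u v uv = by-choice (chosen u) (chosen v) refl refl
      where
      by-choice : ∀ b c → chosen u ≡ b → chosen v ≡ c → u ∈ cover ⊎ v ∈ cover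
      by-choice true  _    cu _  = inj₁ (chosen⇒∈cover cu)
      by-choice false true _  cv = inj₂ (chosen⇒∈cover cv)
      by-choice false false cu cv with <-cmp u v
      ... | tri< u<v _ _ = inj₁ (uncovered⇒∈cover {v = v} (uncovered-edge u<v uv cu cv))
      ... | tri> _ _ v<u = inj₂ (uncovered⇒∈cover {v = u} (uncovered-edge v<u (trans (symm v u) uv) cv cu))
      ... | tri≈ _ refl _ with trans (sym (irrefl u)) uv
      ...   | ()

-- γ leaves room for exactly k' hubs besides the ones every labeling must pay for
budget : ∀ n m k' x → let γ = 8 * n + 3 * m + k' + 2 in
         1 + γ * 2 + n * 8 + m * 3 + x ≤ 3 * γ ∸ 1 → x ≤ k'
budget n m k' x small = +-cancelˡ-≤ spent x k' (subst (spent + x ≤_) (cong (_∸ 1) (3γ≡ n m k')) small)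
  where
  spent : ℕ
  spent = 1 + (8 * n + 3 * m + k' + 2) * 2 + n * 8 + m * 3
  3γ≡ : ∀ n m k' → 3 * (8 * n + 3 * m + k' + 2) ≡ suc (1 + (8 * n + 3 * m + k' + 2) * 2 + n * 8 + m * 3 + k')
  3γ≡ = solve-∀

lemma3 : (n : ℕ) (E' : Fin n → Fin n → Bool) →
         ((u v : Fin n) → E' u v ≡ E' v u) → ((u : Fin n) → E' u u ≡ false) →
         (k' : ℕ) →
         (ℓ : Construction.V n E' k' → Construction.V n E' k' → Bool) →
         Construction.IsHL n E' k' ℓ → Construction.IsOptimal n E' k' ℓ →
         Construction.IsNormalized n E' k' ℓ →
         Construction.size n E' k' ℓ ≤ Construction.k n E' k' →
         Σ (Subset n) λ C → IsVertexCover n E' C × ∣ C ∣ ≤ k'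
lemma3 n E' symm irrefl k' ℓ hl _ (dominated , hub-w , _ , large-gadgets , large-edges) small =
  cover , cover-isVertexCover symm irrefl ,
  ≤-trans ∣cover∣≤ (budget n m k' (#chosen + #uncovered)
                      (≤-trans (size-lower-bound dominated hub-w large-gadgets irrefl large-edges) small))
  where
  open Construction n E' k' using (m)
  open Reduction n E' k'
  open Hubs hl
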